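{- Let $A$ be an infinite set, $I$ a set, $F$ a filter on $\Pi(I)$, and $\theta$ a congruence on the algebra $\Omega(A)^{F}$. Let $Z\subseteq\{\emptyset\}\cup\bigcup F$ be the set of those $R\in\{\emptyset\}\cup\bigcup F$ such that whenever $f,g\in\Omega(A)^{F}$ satisfy $f|_{R}=g|_{R}$, we have $(f,g)\in\theta$. Then $Z$ is a filter on the Boolean algebra $\{\emptyset\}\cup\bigcup F$, and for all $f,g\in\Omega(A)^{F}$ we have $(f,g)\in\theta$ if and only if $\{i\in I\mid f(i)=g(i)\}\in Z$.
   Context: For an infinite set $A$, let $\mathcal{F}$ be the type consisting of a constant symbol $\hat{a}$ for each $a\in A$ and an $n$-ary function symbol $\hat{f}$ for each function $f:A^{n}\rightarrow A$ with $n\geq 1$. $\Omega(A)$ is the algebra of type $\mathcal{F}$ with universe $A$ in which $\hat{a}$ is interpreted as $a$ and $\hat{f}$ as $f$. $\Pi(I)$ is the lattice of partitions of $I$ ordered by refinement; a filter on $\Pi(I)$ is a nonempty subset closed under common refinements and under coarsening. For $f:I\rightarrow A$, $\Pi(f)=\{f^{ -1}(\{x\})\mid x\in A\}\setminus\{\emptyset\}$. For a filter $F$ on $\Pi(I)$, $\Omega(A)^{F}$ is the subalgebra $\{f\in A^{I}\mid \Pi(f)\in F\}$ of the direct power $\Omega(A)^{I}$. Here $\bigcup F$ denotes the set of all blocks of all partitions in $F$; the family $\{\emptyset\}\cup\bigcup F$ is a Boolean algebra of subsets of $I$ under the set operations, and a filter on it is a nonempty upward closed subset closed under finite intersections (possibly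 containing $\emptyset$). -}

module Defs where

open import Level using (0ℓ)
open import Data.Nat using (ℕ; suc)
open import Data.Fin using (Fin)
open import Data.Product using (Σ; ∃; _×_; _,_)
open import Data.Sum using (_⊎_)
open import Data.Empty using (⊥)
open import Relation.Nullary using (¬_)
open import Relation.Binary.PropositionalEquality using (_≡_)
open import Function.Bundles using (_↔_)

Subset : Set → Set₁
Subset X = X → Set

_⊆ˢ_ : {X : Set} → Subset X → Subset X → Set
R ⊆ˢ S = ∀ x → R x → S x

_∩ˢ_ : {X : Set} → Subset X → Subset X → Subset X
(R ∩ˢ S) x = R x × S x

Infinite : Set → Set
Infinite A = ∀ (n : ℕ) → ¬ (Fin n ↔ A)

-- Partitions of I, represented by their equivalence relations.
-- The block of i is {j | E i j}.  Refinement order: P ≤ Q (P finer)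
-- iff E_P ⊆ E_Q.

BinRel : Set → Set₁
BinRel I = I → I → Set

record IsPartition {I : Set} (E : BinRel I) : Set where
  field
    refl  : ∀ i → E i i
    sym   : ∀ i j → E i j → E j i
    trans : ∀ i j k → E i j → E j k → E i k

_≼_ : {I : Set} → BinRel I → BinRel I → Set
P ≼ Q = ∀ i j → P i j → Q i j

_⊓_ : {I : Set} → BinRel I → BinRel I → BinRel I
(P ⊓ Q) i j = P i j × Q i j

record IsPartitionFilter {I : Set} (F : BinRel I → Set) : Set₁ where
  field
    onlyPartitions : ∀ P → F P → IsPartition P
    nonempty       : Σ (BinRel I) F
    meet           : ∀ P Q → F P → F Q → F (P ⊓ Q)
    upward         : ∀ P Q → F P → IsPartition Q → P ≼ Q → F Q

Πf : {I A : Set} → (I → A) → BinRel I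
Πf f i j = f i ≡ f j

_∈Ω^_ : {I A : Set} → (I → A) → (BinRel I → Set) → Set
f ∈Ω^ F = F (Πf f)

-- Elements are functions I → A with Π(f) ∈ F;
-- θ is considered on such elements only (function equality is pointwise).
-- Constant symbols impose no compatibility condition; the n-ary function
-- symbols (n ≥ 1) are all maps A^n → A (A^n as Fin n → A), acting pointwise.
record IsCongruence {I A : Set} (F : BinRel I → Set)
                    (θ : (I → A) → (I → A) → Set) : Set₁ where
  field
    extensional : ∀ f f′ g g′ → (∀ i → f i ≡ f′ i) → (∀ i → g i ≡ g′ i)
                  → θ f g → θ f′ g′
    refl  : ∀ f → f ∈Ω^ F → θ f f
    sym   : ∀ f g → f ∈Ω^ F → g ∈Ω^ F → θ f g → θ g f
    trans : ∀ f g h → f ∈Ω^ F → g ∈Ω^ F → h ∈Ω^ F → θ f g → θ g h → θ f h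
    compatible : ∀ (n : ℕ) (op : (Fin (suc n) → A) → A)
                   (fs gs : Fin (suc n) → I → A)
                 → (∀ k → fs k ∈Ω^ F) → (∀ k → gs k ∈Ω^ F)
                 → (∀ k → θ (fs k) (gs k))
                 → θ (λ i → op (λ k → fs k i)) (λ i → op (λ k → gs k i))

IsBlockOf : {I : Set} → Subset I → BinRel I → Set
IsBlockOf {I} R P = Σ I (λ i → ∀ j → (R j → P i j) × (P i j → R j))

IsEmpty : {I : Set} → Subset I → Set
IsEmpty {I} R = ∀ i → ¬ R i

InBlocks : {I : Set} → (BinRel I → Set) → Subset I → Set₁
InBlocks F R = IsEmpty R ⊎ Σ _ (λ P → F P × IsBlockOf R P)

-- A filter on the Boolean algebra {∅} ∪ ⋃F (may contain ∅).
record IsBAFilter {I : Set} (F : BinRel I → Set) (Z : Subset I → Set₁) : Set₂ where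
  field
    inAlgebra : ∀ R → Z R → InBlocks F R
    nonempty  : Σ (Subset I) Z
    upward    : ∀ R S → Z R → InBlocks F S → R ⊆ˢ S → Z S
    meet      : ∀ R S → Z R → Z S → Z (R ∩ˢ S)

Zset : {I A : Set} → (BinRel I → Set) → ((I → A) → (I → A) → Set)
       → Subset I → Set₁
Zset {I} {A} F θ R =
  InBlocks F R ×
  (∀ (f g : I → A) → f ∈Ω^ F → g ∈Ω^ F → (∀ i → R i → f i ≡ g i) → θ f g)

Eq : {I A : Set} → (I → A) → (I → A) → Subset I
Eq f g i = f i ≡ g i

-- Z is closed under meets because a congruence is transitive: if R, S ∈ Z and f, g
-- agree on R ∩ S, the function h equal to f on R and to g off R lies in Ω(A)^F (R is
-- a block of a partition in F) and is θ-related to f through R and to g through S.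
-- Conversely, if f θ g and f′, g′ agree on Eq f g, applying the operation
-- (a, b, c, d) ↦ (if a = b then c else d) to (f, f, f′, g′) θ (f, g, f′, g′) gives f′ θ g′.
module Submission where

open import Defs
open import Level using (0ℓ)
open import Data.Product using (_×_)
open import Function.Bundles using (_⇔_)
open import Axiom.ExcludedMiddle using (ExcludedMiddle)

open import Data.Bool using (if_then_else_)
open import Data.Vec.Functional using ([]; _∷_)
open import Data.Empty using (⊥-elim)
open import Data.Fin using (zero; suc)
open import Data.Product using (∃; _,_; proj₁; proj₂)
open import Data.Sum using (_⊎_; inj₁; inj₂)
open import Data.Unit using (⊤; tt)
open import Function.Bundles using (mk⇔)
open import Relation.Binary.Definitions using (DecidableEquality)
open import Relation.Binary.PropositionalEquality as ≡ using (_≡_; refl)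
open import Relation.Nullary using (Dec; yes; no; does)
open import Relation.Unary using (Decidable)

if-does-then : {X A : Set} {a b : A} → X → (d : Dec X) → (if does d then a else b) ≡ a
if-does-then x (yes _) = refl
if-does-then x (no ¬x) = ⊥-elim (¬x x)

if-does-else : {X A : Set} {a b : A} → (X → a ≡ b) → (d : Dec X) → (if does d then a else b) ≡ b
if-does-else a≡b (yes x) = a≡b x
if-does-else a≡b (no _)  = refl

kernel-isPartition : {I A : Set} (f : I → A) → IsPartition (Πf f)
kernel-isPartition f = record
  { refl = λ _ → refl ; sym = λ _ _ → ≡.sym ; trans = λ _ _ _ → ≡.trans }

total-isPartition : {I : Set} → IsPartition {I} (λ _ _ → ⊤)
total-isPartition = record
  { refl = λ _ → tt ; sym = λ _ _ _ → tt ; trans = λ _ _ _ _ _ → tt }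

module _ {I : Set} {P : BinRel I} (isP : IsPartition P) {R : Subset I} (R-block : IsBlockOf R P) where
  open IsPartition isP

  block-related : ∀ {i j} → R i → R j → P i j
  block-related {i} {j} ri rj = let i₀ , blk = R-block in
    trans i i₀ j (sym i₀ i (proj₁ (blk i) ri)) (proj₁ (blk j) rj)

  block-closed : ∀ {i j} → R i → P i j → R j
  block-closed {i} {j} ri pij = let i₀ , blk = R-block in
    proj₂ (blk j) (trans i₀ i j (proj₁ (blk i) ri) pij)

block-⊓ : {I : Set} {P Q : BinRel I} {R S : Subset I} → IsPartition P → IsPartition Q
        → IsBlockOf R P → IsBlockOf S Q → ∀ {k} → R k → S k → IsBlockOf (R ∩ˢ S) (P ⊓ Q)
block-⊓ isP isQ R-block S-block {k} rk sk = k , λ j →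
    (λ (rj , sj) → block-related isP R-block rk rj , block-related isQ S-block sk sj)
  , (λ (pkj , qkj) → block-closed isP R-block rk pkj , block-closed isQ S-block sk qkj)

patch : {I A : Set} {R : Subset I} → Decidable R → (I → A) → (I → A) → I → A
patch R? f g i = if does (R? i) then f i else g i

patch-kernel : {I A : Set} {P : BinRel I} {R : Subset I} → IsPartition P → IsBlockOf R P
             → (R? : Decidable R) (f g : I → A) → (Πf f ⊓ (Πf g ⊓ P)) ≼ Πf (patch R? f g)
patch-kernel isP R-block R? f g i j (fij , gij , pij) with R? i | R? j
... | yes _  | yes _  = fij
... | no _   | no _   = gij
... | yes ri | no ¬rj = ⊥-elim (¬rj (block-closed isP R-block ri pij))
... | no ¬ri | yes rj = ⊥-elim (¬ri (block-closed isP R-block rj (IsPartition.sym isP i j pij)))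

equalizerPartition : {I A : Set} → (I → A) → (I → A) → BinRel I
equalizerPartition f g i j = (Eq f g i × Eq f g j) ⊎ (Πf f ⊓ Πf g) i j

module _ {I A : Set} (f g : I → A) where

  equalizerPartition-isPartition : IsPartition (equalizerPartition f g)
  equalizerPartition-isPartition = record
    { refl  = λ _ → inj₂ (refl , refl)
    ; sym   = λ { _ _ (inj₁ (ei , ej)) → inj₁ (ej , ei)
                ; _ _ (inj₂ (fij , gij)) → inj₂ (≡.sym fij , ≡.sym gij) }
    ; trans = trans′ }
    where
    trans′ : ∀ i j k → equalizerPartition f g i j → equalizerPartition f g j k
           → equalizerPartition f g i k
    trans′ i j k (inj₁ (ei , _))    (inj₁ (_ , ek))    = inj₁ (ei , ek)
    trans′ i j k (inj₁ (ei , ej))   (inj₂ (fjk , gjk)) = inj₁ (ei , ≡.trans (≡.sym fjk) (≡.trans ej gjk))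
    trans′ i j k (inj₂ (fij , gij)) (inj₁ (ej , ek))   = inj₁ (≡.trans fij (≡.trans ej (≡.sym gij)) , ek)
    trans′ i j k (inj₂ (fij , gij)) (inj₂ (fjk , gjk)) = inj₂ (≡.trans fij fjk , ≡.trans gij gjk)

  equalizer-isBlock : ∀ {k} → Eq f g k → IsBlockOf (Eq f g) (equalizerPartition f g)
  equalizer-isBlock {k} ek = k , λ j → (λ ej → inj₁ (ek , ej)) , back j
    where
    back : ∀ j → equalizerPartition f g k j → Eq f g j
    back j (inj₁ (_ , ej))    = ej
    back j (inj₂ (fkj , gkj)) = ≡.trans (≡.sym fkj) (≡.trans ek gkj)

module _ {I : Set} {F : BinRel I → Set} (isF : IsPartitionFilter F) where
  open IsPartitionFilter isF

  inBlocks-nonempty : {R : Subset I} → Dec (∃ R) → (∀ {k} → R k → InBlocks F R) → InBlocks F R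
  inBlocks-nonempty (yes (k , rk)) R-inBlocks = R-inBlocks rk
  inBlocks-nonempty (no ∄R)        _          = inj₁ (λ i ri → ∄R (i , ri))

  inBlocks-full : Dec I → InBlocks F (λ _ → ⊤)
  inBlocks-full (no ¬I) = inj₁ (λ i _ → ¬I i)
  inBlocks-full (yes k) with nonempty
  ... | P , FP = inj₂ ( (λ _ _ → ⊤) , upward P _ FP total-isPartition (λ _ _ _ → tt)
                      , k , λ _ → (λ _ → tt) , (λ _ → tt))

  inBlocks-∩ : {R S : Subset I} → Dec (∃ (R ∩ˢ S)) → InBlocks F R → InBlocks F S → InBlocks F (R ∩ˢ S)
  inBlocks-∩ _ (inj₁ ∅R) _ = inj₁ (λ i (ri , _) → ∅R i ri)
  inBlocks-∩ _ _ (inj₁ ∅S) = inj₁ (λ i (_ , si) → ∅S i si)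
  inBlocks-∩ R∩S? (inj₂ (P , FP , R-block)) (inj₂ (Q , FQ , S-block)) =
    inBlocks-nonempty R∩S? λ (rk , sk) →
      inj₂ (P ⊓ Q , meet P Q FP FQ
           , block-⊓ (onlyPartitions P FP) (onlyPartitions Q FQ) R-block S-block rk sk)

  module _ {A : Set} {f g : I → A} (fΩ : f ∈Ω^ F) (gΩ : g ∈Ω^ F) where

    inBlocks-Eq : Dec (∃ (Eq f g)) → InBlocks F (Eq f g)
    inBlocks-Eq Eq? = inBlocks-nonempty Eq? λ ek →
      inj₂ (equalizerPartition f g
           , upward _ _ (meet _ _ fΩ gΩ) (equalizerPartition-isPartition f g) (λ _ _ → inj₂)
           , equalizer-isBlock f g ek)

    patch-∈Ω : {P : BinRel I} {R : Subset I} → F P → IsBlockOf R P → (R? : Decidable R)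
             → patch R? f g ∈Ω^ F
    patch-∈Ω {P} FP R-block R? =
      upward _ _ (meet _ _ fΩ (meet _ _ gΩ FP)) (kernel-isPartition _)
             (patch-kernel (onlyPartitions P FP) R-block R? f g)

module _ {I A : Set} {F : BinRel I → Set} (isF : IsPartitionFilter F)
         {θ : (I → A) → (I → A) → Set} (isθ : IsCongruence F θ) where
  open IsCongruence isθ renaming (refl to θ-refl; trans to θ-trans)

  Determines : Subset I → Set
  Determines R = ∀ (f g : I → A) → f ∈Ω^ F → g ∈Ω^ F → (∀ i → R i → f i ≡ g i) → θ f g

  θ-pointwise : ∀ {f g} → f ∈Ω^ F → (∀ i → f i ≡ g i) → θ f g
  θ-pointwise {f} {g} fΩ f≗g = extensional f f f g (λ _ → refl) f≗g (θ-refl f fΩ)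

  determines-full : Determines (λ _ → ⊤)
  determines-full f g fΩ _ f≗g = θ-pointwise fΩ (λ i → f≗g i tt)

  determines-mono : ∀ {R S} → R ⊆ˢ S → Determines R → Determines S
  determines-mono R⊆S R-det f g fΩ gΩ agree = R-det f g fΩ gΩ (λ i ri → agree i (R⊆S i ri))

  determines-∩ : ∀ {R S} → Decidable R → InBlocks F R → Determines R → Determines S
               → Determines (R ∩ˢ S)
  determines-∩ _ (inj₁ ∅R) R-det _ f g fΩ gΩ _ = R-det f g fΩ gΩ (λ i ri → ⊥-elim (∅R i ri))
  determines-∩ R? (inj₂ (P , FP , R-block)) R-det S-det f g fΩ gΩ agree =
    θ-trans f h g fΩ hΩ gΩ
      (R-det f h fΩ hΩ (λ i ri → ≡.sym (if-does-then ri (R? i))))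
      (S-det h g hΩ gΩ (λ i si → if-does-else (λ ri → agree i (ri , si)) (R? i)))
    where
    h : I → A
    h = patch R? f g
    hΩ : h ∈Ω^ F
    hΩ = patch-∈Ω isF fΩ gΩ FP R-block R?

  compatible₄ : (op : A → A → A → A → A) {f₁ f₂ f₃ f₄ g₁ g₂ g₃ g₄ : I → A}
              → f₁ ∈Ω^ F → f₂ ∈Ω^ F → f₃ ∈Ω^ F → f₄ ∈Ω^ F
              → g₁ ∈Ω^ F → g₂ ∈Ω^ F → g₃ ∈Ω^ F → g₄ ∈Ω^ F
              → θ f₁ g₁ → θ f₂ g₂ → θ f₃ g₃ → θ f₄ g₄
              → θ (λ i → op (f₁ i) (f₂ i) (f₃ i) (f₄ i)) (λ i → op (g₁ i) (g₂ i) (g₃ i) (g₄ i))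
  compatible₄ op {f₁} {f₂} {f₃} {f₄} {g₁} {g₂} {g₃} {g₄} f₁Ω f₂Ω f₃Ω f₄Ω g₁Ω g₂Ω g₃Ω g₄Ω θ₁ θ₂ θ₃ θ₄ =
    compatible 3 (λ v → op (v zero) (v (suc zero)) (v (suc (suc zero))) (v (suc (suc (suc zero)))))
      (f₁ ∷ f₂ ∷ f₃ ∷ f₄ ∷ []) (g₁ ∷ g₂ ∷ g₃ ∷ g₄ ∷ [])
      (λ { zero → f₁Ω ; (suc zero) → f₂Ω ; (suc (suc zero)) → f₃Ω ; (suc (suc (suc zero))) → f₄Ω })
      (λ { zero → g₁Ω ; (suc zero) → g₂Ω ; (suc (suc zero)) → g₃Ω ; (suc (suc (suc zero))) → g₄Ω })
      (λ { zero → θ₁ ; (suc zero) → θ₂ ; (suc (suc zero)) → θ₃ ; (suc (suc (suc zero))) → θ₄ })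

  θ⇒determines-Eq : DecidableEquality A → ∀ {f g} → f ∈Ω^ F → g ∈Ω^ F → θ f g → Determines (Eq f g)
  θ⇒determines-Eq _≟_ {f} {g} fΩ gΩ θfg f′ g′ f′Ω g′Ω agree =
    extensional _ f′ _ g′
      (λ i → if-does-then refl (f i ≟ f i))
      (λ i → if-does-else (agree i) (f i ≟ g i))
      (compatible₄ select fΩ fΩ f′Ω g′Ω fΩ gΩ f′Ω g′Ω (θ-refl f fΩ) θfg (θ-refl f′ f′Ω) (θ-refl g′ g′Ω))
    where
    select : A → A → A → A → A
    select a b c d = if does (a ≟ b) then c else d

module _ (em : ExcludedMiddle 0ℓ) {I A : Set} {F : BinRel I → Set} (isF : IsPartitionFilter F)
         {θ : (I → A) → (I → A) → Set} (isθ : IsCongruence F θ) where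

  Zset-isBAFilter : IsBAFilter F (Zset F θ)
  Zset-isBAFilter = record
    { inAlgebra = λ _ → proj₁
    ; nonempty  = (λ _ → ⊤) , inBlocks-full isF em , determines-full isF isθ
    ; upward    = λ _ _ (_ , R-det) S-inBlocks R⊆S →
                    S-inBlocks , determines-mono isF isθ R⊆S R-det
    ; meet      = λ _ _ (R-inBlocks , R-det) (S-inBlocks , S-det) →
                    inBlocks-∩ isF em R-inBlocks S-inBlocks
                  , determines-∩ isF isθ (λ _ → em) R-inBlocks R-det S-det }

  θ⇔Zset-Eq : ∀ (f g : I → A) → f ∈Ω^ F → g ∈Ω^ F → (θ f g ⇔ Zset F θ (Eq f g))
  θ⇔Zset-Eq f g fΩ gΩ = mk⇔
    (λ θfg → inBlocks-Eq isF fΩ gΩ em , θ⇒determines-Eq isF isθ (λ _ _ → em) fΩ gΩ θfg)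
    (λ (_ , Eq-det) → Eq-det f g fΩ gΩ (λ _ fi≡gi → fi≡gi))

mainTheorem2 : ExcludedMiddle 0ℓ → ExcludedMiddle (Level.suc 0ℓ) → ExcludedMiddle (Level.suc (Level.suc 0ℓ))
    → (A I : Set) → Infinite A
    → (F : BinRel I → Set) → IsPartitionFilter F
    → (θ : (I → A) → (I → A) → Set) → IsCongruence F θ
    → IsBAFilter F (Zset F θ)
      × (∀ (f g : I → A) → f ∈Ω^ F → g ∈Ω^ F → (θ f g ⇔ Zset F θ (Eq f g)))
mainTheorem2 em _ _ A I _ F isF θ isθ = Zset-isBAFilter em isF isθ , θ⇔Zset-Eq em isF isθ
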